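{- Let $k\ge1$ and let $(c_1,\dots,c_k)$ and $(m_1,\dots,m_k)$ be a consistent pair of sequences, with $n=c_1+\dots+c_k$. Run the stack procedure described in the context on this input. Then, for each iteration $i\in\{1,\dots,k\}$, immediately after Step 2 of iteration $i$ the stack $\mathscr{A}$ is empty if and only if $i=k$. As a result, the output $\pi$ is a permutation of length $n$ (i.e. at the end, $\mathscr{B}$ contains all of $1,\dots,n$).
   Context: A pair of sequences of positive integers $(c_1,\dots,c_k)$ and $(m_1,\dots,m_k)$ is consistent if: $c_1\ge 2$; $c_1+c_2+\dots+c_k=n$; $n=m_1>m_2>\dots>m_k$; and $m_i>c_i+c_{i+1}+\dots+c_k$ for all $1<i\le k$. The stack procedure: let $M=\{m_2,\dots,m_k\}$; start with two empty stacks $\mathscr{A},\mathscr{B}$ and a counter $p:=n$. For $i=1,2,\dots,k$ in order: (Step 1) repeat $c_i$ times: push $p$ onto $\mathscr{A}$ and decrease $p$ by $1$ (so the values $n-\sum_{t<i}c_t,\dots,n-\sum_{t\le i}c_t+1$ are pushed in decreasing order, the last one on top); (Step 2) while $\mathscr{A}$ is nonempty and the top of $\mathscr{A}$ is not in $M$, pop the top of $\mathscr{A}$ and push it onto $\mathscr{B}$; (Step 3) if $\mathscr{A}$ is nonempty, pop the top of $\mathscr{A}$ and push it onto $\mathscr{B}$. The output $\pi$ is the word obtained by reading $\mathscr{B}$ from top to bottom ($\pi_1$ is the top of $\mathscr{B}$). -}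

module Defs where

open import Data.Nat using (ℕ; zero; suc; _+_; _∸_; _≤_; _<_)
open import Data.Nat.Properties using (_≟_)
open import Data.List using (List; []; _∷_; drop; take; foldl)
open import Data.Nat.ListAction using (sum)
open import Data.List.Membership.DecPropositional _≟_ using (_∈?_)
open import Data.Product using (_×_; _,_)
open import Relation.Binary.PropositionalEquality using (_≡_)
open import Relation.Nullary using (yes; no)

-- 1-indexed access to a list (default 0 out of range); at xs 1 is the first entry.
at : List ℕ → ℕ → ℕ
at []       _             = 0
at (x ∷ xs) zero          = 0
at (x ∷ xs) (suc zero)    = x
at (x ∷ xs) (suc (suc i)) = at xs (suc i)

record Consistent (k : ℕ) (c m : List ℕ) : Set where
  field
    len-c   : Data.List.length c ≡ k
    len-m   : Data.List.length m ≡ k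
    c₁≥2    : 2 ≤ at c 1
    c-pos   : ∀ i → 1 ≤ i → i ≤ k → 1 ≤ at c i
    m-pos   : ∀ i → 1 ≤ i → i ≤ k → 1 ≤ at m i
    m₁≡n    : at m 1 ≡ sum c
    m-decr  : ∀ i → 1 ≤ i → i < k → at m (suc i) < at m i
    m-big   : ∀ i → 1 < i → i ≤ k → sum (drop (i ∸ 1) c) < at m i

-- State of the stack procedure: stack A, stack B (head of a list = top), counter p.
record State : Set where
  constructor st
  field
    A : List ℕ
    B : List ℕ
    p : ℕ

open State public

initial : ℕ → State
initial n = st [] [] n

step1 : ℕ → State → State
step1 zero    s           = s
step1 (suc c) (st a b p)  = step1 c (st (p ∷ a) b (p ∸ 1))

step2-aux : List ℕ → List ℕ → List ℕ → ℕ → State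
step2-aux M []      b p = st [] b p
step2-aux M (x ∷ a) b p with x ∈? M
... | yes _ = st (x ∷ a) b p
... | no  _ = step2-aux M a (x ∷ b) p

step2 : List ℕ → State → State
step2 M (st a b p) = step2-aux M a b p

step3 : State → State
step3 (st []      b p) = st [] b p
step3 (st (x ∷ a) b p) = st a (x ∷ b) p

iteration : List ℕ → State → ℕ → State
iteration M s cᵢ = step3 (step2 M (step1 cᵢ s))

Mset : List ℕ → List ℕ
Mset m = drop 1 m

afterStep2 : List ℕ → List ℕ → ℕ → State
afterStep2 c m i =
  step2 (Mset m) (step1 (at c i) (foldl (iteration (Mset m)) (initial (sum c)) (take (i ∸ 1) c)))

-- Final state and output word π (B read from top to bottom).
finalState : List ℕ → List ℕ → State
finalState c m = foldl (iteration (Mset m)) (initial (sum c)) c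

output : List ℕ → List ℕ → List ℕ
output c m = B (finalState c m)

{-# OPTIONS --safe #-}
-- Count the elements of M = {m₂, …, m_k}. Nothing pushed is ever lost, and B gains exactly one
-- element of M per iteration: Step 2 moves only non-members, Step 3 the member left on top.
-- Before Step 2 of iteration j+1 < k, the j+1 values m₂ > ⋯ > m_{j+2} exceed the counter
-- c_{j+2} + ⋯ + c_k, so they have been pushed, while B holds only j members of M: some member is
-- still in A and Step 2 stops on it. In iteration k everything has been pushed and B already holds
-- all k-1 members of M, so Step 2 empties A and B ends up holding each of 1, …, n once.
module Submission where

open import Defs
open import Data.Nat using (ℕ; zero; suc; _+_; _≤_; _<_; _>_; _≤?_; z≤n; s≤s)
open import Data.Nat.Properties
open import Data.List using (List; []; _∷_; _++_; _∷ʳ_; length; filter; take; drop; foldl;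
  applyUpTo; applyDownFrom; reverse)
open import Data.List.Properties
  using (length-++; filter-++; filter-accept; filter-reject; filter-all; filter-none; length-filter;
    foldl-++; take-all; drop-all; ++-identityʳ; reverse-applyUpTo)
open import Data.Nat.ListAction using (sum)
open import Data.List.Membership.DecPropositional _≟_ using (_∈_; _∉_; _∈?_)
open import Data.List.Relation.Unary.Any using (here; there)
open import Data.List.Relation.Unary.All as All using (All; []; _∷_)
open import Data.List.Relation.Unary.AllPairs as AllPairs using (AllPairs; []; _∷_)
open import Data.List.Relation.Unary.Linked using (Linked; []; [-]; _∷_)
open import Data.List.Relation.Unary.Linked.Properties using (Linked⇒AllPairs)
open import Data.List.Relation.Binary.Permutation.Propositional
  using (_↭_; ↭-refl; ↭-sym; ↭-trans; ↭-reflexive; module PermutationReasoning)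
open import Data.List.Relation.Binary.Permutation.Propositional.Properties
  using (↭-length; filter-↭; shift; ++⁺ˡ; ↭-reverse)
open import Data.Product using (_×_; _,_; proj₁; proj₂)
open import Data.Sum using (inj₁; inj₂)
open import Data.Empty using (⊥-elim)
open import Function using (_∘_)
open import Function.Bundles using (_⇔_; mk⇔)
open import Relation.Binary.PropositionalEquality
open import Relation.Nullary using (yes; no; ¬_)

at-All : ∀ {P : ℕ → Set} xs → (∀ i → 1 ≤ i → i ≤ length xs → P (at xs i)) → All P xs
at-All []       h = []
at-All (x ∷ xs) h =
  h 1 ≤-refl (s≤s z≤n) ∷ at-All xs λ { (suc i) _ i≤ → h (suc (suc i)) (s≤s z≤n) (s≤s i≤) }

All-at : ∀ {P : ℕ → Set} {xs} → All P xs → ∀ i → 1 ≤ i → i ≤ length xs → P (at xs i)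
All-at (px ∷ _)  (suc zero)    _ _        = px
All-at (_ ∷ pxs) (suc (suc i)) _ (s≤s i≤) = All-at pxs (suc i) (s≤s z≤n) i≤

at-Linked : ∀ xs → (∀ i → 1 ≤ i → i < length xs → at xs (suc i) < at xs i) → Linked _>_ xs
at-Linked []           h = []
at-Linked (x ∷ [])     h = [-]
at-Linked (x ∷ y ∷ xs) h = h 1 ≤-refl (s≤s (s≤s z≤n)) ∷
  at-Linked (y ∷ xs) λ { (suc i) _ i< → h (suc (suc i)) (s≤s z≤n) (s≤s i<) }

take-at : ∀ (xs : List ℕ) j → j < length xs → take (suc j) xs ≡ take j xs ∷ʳ at xs (suc j)
take-at (x ∷ xs) zero    _        = refl
take-at (x ∷ xs) (suc j) (s≤s j<) = cong (x ∷_) (take-at xs j j<)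

sum-drop-at : ∀ (xs : List ℕ) j → j < length xs →
  sum (drop j xs) ≡ at xs (suc j) + sum (drop (suc j) xs)
sum-drop-at (x ∷ xs) zero    _        = refl
sum-drop-at (x ∷ xs) (suc j) (s≤s j<) = sum-drop-at xs j j<

take-≥-at : ∀ {xs} → AllPairs _>_ xs → ∀ i → 1 ≤ i → i ≤ length xs → All (at xs i ≤_) (take i xs)
take-≥-at (_ ∷ _) (suc zero) _ _ = ≤-refl ∷ []
take-≥-at {x ∷ xs} (x>xs ∷ desc) (suc (suc i)) _ (s≤s i≤) =
  <⇒≤ (All-at x>xs (suc i) (s≤s z≤n) i≤) ∷ take-≥-at desc (suc i) (s≤s z≤n) i≤

filter-≤-suc-∉ : ∀ {q} xs → suc q ∉ xs → filter (_≤? suc q) xs ≡ filter (_≤? q) xs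
filter-≤-suc-∉ []           _   = refl
filter-≤-suc-∉ {q} (y ∷ xs) sq∉ with y ≤? q
... | yes y≤q = trans (filter-accept (_≤? suc q) (m≤n⇒m≤1+n y≤q))
                  (trans (cong (y ∷_) (filter-≤-suc-∉ xs (sq∉ ∘ there))) (sym (filter-accept (_≤? q) y≤q)))
... | no y≰q  = trans (filter-reject (_≤? suc q) y≰sq)
                  (trans (filter-≤-suc-∉ xs (sq∉ ∘ there)) (sym (filter-reject (_≤? q) y≰q)))
  where
  y≰sq : ¬ y ≤ suc q
  y≰sq y≤sq = sq∉ (here (≤-antisym (≰⇒> y≰q) y≤sq))

filter-≤-suc-∈ : ∀ {q xs} → AllPairs _>_ xs → suc q ∈ xs →
  length (filter (_≤? suc q) xs) ≡ suc (length (filter (_≤? q) xs))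
filter-≤-suc-∈ {q} {y ∷ xs} (y>xs ∷ _) (here refl) =
  trans (cong length (filter-accept (_≤? suc q) (≤-refl {suc q})))
    (cong suc (trans (cong length (filter-≤-suc-∉ xs λ sq∈ → n≮n (suc q) (All.lookup y>xs sq∈)))
      (cong length (sym (filter-reject (_≤? q) (n≮n q))))))
filter-≤-suc-∈ {q} {y ∷ xs} (y>xs ∷ desc) (there sq∈) =
  trans (cong length (filter-reject (_≤? suc q) (<⇒≱ y>sq)))
    (trans (filter-≤-suc-∈ desc sq∈)
      (cong (suc ∘ length) (sym (filter-reject (_≤? q) (<⇒≱ (<-trans (n<1+n q) y>sq))))))
  where y>sq = All.lookup y>xs sq∈

filter-≤-take : ∀ {q} i xs → All (q <_) (take i xs) → i ≤ length xs →
  i + length (filter (_≤? q) xs) ≤ length xs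
filter-≤-take     zero    xs       _            _        = length-filter _ xs
filter-≤-take {q} (suc i) (x ∷ xs) (q<x ∷ q<xs) (s≤s i≤) =
  subst (λ ys → suc i + length ys ≤ suc (length xs)) (sym (filter-reject (_≤? q) (<⇒≱ q<x)))
    (s≤s (filter-≤-take i xs q<xs i≤))

module _ (M : List ℕ) where

  countIn : List ℕ → ℕ
  countIn xs = length (filter (_∈? M) xs)

  countIn-++ : ∀ xs ys → countIn (xs ++ ys) ≡ countIn xs + countIn ys
  countIn-++ xs ys = trans (cong length (filter-++ (_∈? M) xs ys)) (length-++ (filter (_∈? M) xs))

  countIn-∷-∈ : ∀ {x xs} → x ∈ M → countIn (x ∷ xs) ≡ suc (countIn xs)
  countIn-∷-∈ = cong length ∘ filter-accept (_∈? M)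

  countIn-∷-∉ : ∀ {x xs} → x ∉ M → countIn (x ∷ xs) ≡ countIn xs
  countIn-∷-∉ = cong length ∘ filter-reject (_∈? M)

  countIn-↭ : ∀ {xs ys} → xs ↭ ys → countIn xs ≡ countIn ys
  countIn-↭ = ↭-length ∘ filter-↭ (_∈? M)

  countIn-downFrom : AllPairs _>_ M → All (1 ≤_) M → ∀ q →
    countIn (applyDownFrom suc q) ≡ length (filter (_≤? q) M)
  countIn-downFrom desc pos zero =
    sym (cong length (filter-none (_≤? 0) (All.map (λ 1≤y y≤0 → <⇒≱ 1≤y y≤0) pos)))
  countIn-downFrom desc pos (suc q) with suc q ∈? M
  ... | yes sq∈ = trans (cong suc (countIn-downFrom desc pos q)) (sym (filter-≤-suc-∈ desc sq∈))
  ... | no sq∉  = trans (countIn-downFrom desc pos q) (cong length (sym (filter-≤-suc-∉ M sq∉)))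

-- applyDownFrom suc p = p, p-1, …, 1 are the values not pushed yet.
contents : State → List ℕ
contents (st a b p) = b ++ a ++ applyDownFrom suc p

step3-[] : ∀ s → A s ≡ [] → step3 s ≡ s
step3-[] (st _ b p) refl = refl

data Halted (M : List ℕ) : List ℕ → Set where
  empty   : Halted M []
  blocked : ∀ {x} → x ∈ M → ∀ a → Halted M (x ∷ a)

step2-aux-Halted : ∀ M a b p → Halted M (A (step2-aux M a b p))
step2-aux-Halted M []      b p = empty
step2-aux-Halted M (x ∷ a) b p with x ∈? M
... | yes x∈ = blocked x∈ a
... | no _   = step2-aux-Halted M a (x ∷ b) p

step2-Halted : ∀ M s → Halted M (A (step2 M s))
step2-Halted M (st a b p) = step2-aux-Halted M a b p

module _ (M : List ℕ) (n : ℕ) where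

  record Balanced (j q : ℕ) (s : State) : Set where
    field
      counter   : p s ≡ q
      conserved : contents s ↭ applyDownFrom suc n
      popped    : countIn M (B s) ≡ j

  open Balanced

  step1-Balanced : ∀ {j q} x {s} → Balanced j (x + q) s → Balanced j q (step1 x s)
  step1-Balanced zero bal = bal
  step1-Balanced (suc x) {st a b _} record { counter = refl ; conserved = cv ; popped = pp } =
    step1-Balanced x record
      { counter = refl ; conserved = ↭-trans (++⁺ˡ b (↭-sym (shift _ a _))) cv ; popped = pp }

  step2-aux-Balanced : ∀ {j q} a b p → Balanced j q (st a b p) → Balanced j q (step2-aux M a b p)
  step2-aux-Balanced []      b p bal = bal
  step2-aux-Balanced (x ∷ a) b p bal with x ∈? M
  ... | yes _  = bal
  ... | no x∉ = step2-aux-Balanced a (x ∷ b) p record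
    { counter   = counter bal
    ; conserved = ↭-trans (↭-sym (shift x b _)) (conserved bal)
    ; popped    = trans (countIn-∷-∉ M x∉) (popped bal)
    }

  step3-Balanced : ∀ {j q x a b p} → x ∈ M → Balanced j q (st (x ∷ a) b p) →
    Balanced (suc j) q (step3 (st (x ∷ a) b p))
  step3-Balanced {x = x} {b = b} x∈ bal = record
    { counter   = counter bal
    ; conserved = ↭-trans (↭-sym (shift x b _)) (conserved bal)
    ; popped    = trans (countIn-∷-∈ M x∈) (cong suc (popped bal))
    }

  balance : ∀ {j q s} → Balanced j q s →
    j + (countIn M (A s) + countIn M (applyDownFrom suc q)) ≡ countIn M (applyDownFrom suc n)
  balance {j} {q} {st a b p} bal = begin
    j + (countIn M a + countIn M (applyDownFrom suc q))
      ≡⟨ cong₂ (λ j q → j + (countIn M a + countIn M (applyDownFrom suc q)))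
               (sym (popped bal)) (sym (counter bal)) ⟩
    countIn M b + (countIn M a + countIn M (applyDownFrom suc p))
      ≡⟨ cong (countIn M b +_) (sym (countIn-++ M a _)) ⟩
    countIn M b + countIn M (a ++ applyDownFrom suc p)
      ≡⟨ sym (countIn-++ M b _) ⟩
    countIn M (contents (st a b p))
      ≡⟨ countIn-↭ M (conserved bal) ⟩
    countIn M (applyDownFrom suc n) ∎
    where open ≡-Reasoning

  drained : ∀ {j s} → Balanced j 0 s → A s ≡ [] → B s ↭ applyDownFrom suc n
  drained {s = st _ b _} record { counter = refl ; conserved = cv } refl =
    ↭-trans (↭-reflexive (sym (++-identityʳ b))) cv

  Halted-pop : ∀ {j q a b p} → j + countIn M (applyDownFrom suc q) < countIn M (applyDownFrom suc n) →
    Balanced j q (st a b p) → Halted M a → (a ≢ []) × Balanced (suc j) q (step3 (st a b p))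
  Halted-pop bound bal empty = ⊥-elim (<-irrefl (balance bal) bound)
  Halted-pop bound bal (blocked x∈ _) = (λ ()) , step3-Balanced x∈ bal

  Halted-empty : ∀ {j q a b p} → countIn M (applyDownFrom suc n) ≤ j + countIn M (applyDownFrom suc q) →
    Balanced j q (st a b p) → Halted M a → a ≡ []
  Halted-empty bound bal empty = refl
  Halted-empty {j} {q} bound bal (blocked {x} x∈ a) = ⊥-elim (<⇒≱ pending< bound)
    where
    open ≤-Reasoning
    pending< : j + countIn M (applyDownFrom suc q) < countIn M (applyDownFrom suc n)
    pending< = begin-strict
      j + countIn M (applyDownFrom suc q)
        <⟨ +-monoʳ-< j (m<n+m _ (subst (0 <_) (sym (countIn-∷-∈ M x∈)) (s≤s z≤n))) ⟩
      j + (countIn M (x ∷ a) + countIn M (applyDownFrom suc q))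
        ≡⟨ balance bal ⟩
      countIn M (applyDownFrom suc n) ∎

module StackRun (K : ℕ) (c : List ℕ) (m₁ : ℕ) (M : List ℕ) (cons : Consistent (suc K) c (m₁ ∷ M)) where
  open Consistent cons using (len-c; len-m; m-pos; m₁≡n; m-decr; m-big)

  n : ℕ
  n = sum c

  stateAfter : ℕ → State
  stateAfter j = foldl (iteration M) (initial n) (take j c)

  halfway : ℕ → State
  halfway j = step2 M (step1 (at c (suc j)) (stateAfter j))

  Invariant : ℕ → State → Set
  Invariant j = Balanced M n j (sum (drop j c))

  descending : AllPairs _>_ (m₁ ∷ M)
  descending = Linked⇒AllPairs (λ x>y y>z → <-trans y>z x>y)
    (at-Linked (m₁ ∷ M) λ i 1≤i i< → m-decr i 1≤i (subst (i <_) len-m i<))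

  length-M : length M ≡ K
  length-M = suc-injective len-m

  M-pos : All (1 ≤_) M
  M-pos = All.tail (at-All (m₁ ∷ M) λ i 1≤i i≤ → m-pos i 1≤i (subst (i ≤_) len-m i≤))

  M-≤n : All (_≤ n) M
  M-≤n = All.map (λ y<m₁ → subst (_ ≤_) m₁≡n (<⇒≤ y<m₁)) (AllPairs.head descending)

  countIn-M-downFrom : ∀ q → countIn M (applyDownFrom suc q) ≡ length (filter (_≤? q) M)
  countIn-M-downFrom = countIn-downFrom M (AllPairs.tail descending) M-pos

  total : countIn M (applyDownFrom suc n) ≡ K
  total = trans (countIn-M-downFrom n) (trans (cong length (filter-all (_≤? n) M-≤n)) length-M)

  pending : ∀ {j} → j < K → j + countIn M (applyDownFrom suc (sum (drop (suc j) c))) < K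
  pending {j} j<K = subst₂ _≤_ (cong (suc j +_) (sym (countIn-M-downFrom _))) length-M
    (filter-≤-take (suc j) M (All.map (<-≤-trans q<) first-above) sj≤)
    where
    sj≤ : suc j ≤ length M
    sj≤ = subst (suc j ≤_) (sym length-M) j<K
    q< : sum (drop (suc j) c) < at M (suc j)
    q< = m-big (suc (suc j)) (s≤s (s≤s z≤n)) (s≤s j<K)
    first-above : All (at M (suc j) ≤_) (take (suc j) M)
    first-above = take-≥-at (AllPairs.tail descending) (suc j) (s≤s z≤n) sj≤

  j<length-c : ∀ {j} → j ≤ K → j < length c
  j<length-c j≤K = subst (_ <_) (sym len-c) (s≤s j≤K)

  stateAfter-suc : ∀ {j} → j ≤ K → stateAfter (suc j) ≡ step3 (halfway j)
  stateAfter-suc {j} j≤K = trans (cong (foldl (iteration M) (initial n)) (take-at c j (j<length-c j≤K)))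
    (foldl-++ (iteration M) (initial n) (take j c) (at c (suc j) ∷ []))

  halfway-Balanced : ∀ {j} → j ≤ K → Invariant j (stateAfter j) →
    Balanced M n j (sum (drop (suc j) c)) (halfway j)
  halfway-Balanced {j} j≤K inv = step2-aux-Balanced M n _ _ _ (step1-Balanced M n (at c (suc j))
    (subst (λ q → Balanced M n j q (stateAfter j)) (sum-drop-at c j (j<length-c j≤K)) inv))

  halfway-Halted : ∀ j → Halted M (A (halfway j))
  halfway-Halted j = step2-Halted M (step1 (at c (suc j)) (stateAfter j))

  pops-before-last : ∀ {j} → j < K → Invariant j (stateAfter j) →
    (A (halfway j) ≢ []) × Invariant (suc j) (step3 (halfway j))
  pops-before-last {j} j<K inv = Halted-pop M n (subst (_ <_) (sym total) (pending j<K))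
    (halfway-Balanced (<⇒≤ j<K) inv) (halfway-Halted j)

  invariant : ∀ j → j ≤ K → Invariant j (stateAfter j)
  invariant zero    _   = record { counter = refl ; conserved = ↭-refl ; popped = refl }
  invariant (suc j) j<K = subst (Invariant (suc j)) (sym (stateAfter-suc (<⇒≤ j<K)))
    (proj₂ (pops-before-last j<K (invariant j (<⇒≤ j<K))))

  counter-exhausted : sum (drop (suc K) c) ≡ 0
  counter-exhausted = cong sum (drop-all (suc K) c (≤-reflexive len-c))

  last-Balanced : Balanced M n K 0 (halfway K)
  last-Balanced = subst (λ q → Balanced M n K q (halfway K)) counter-exhausted
    (halfway-Balanced ≤-refl (invariant K ≤-refl))

  empties-at-last : A (halfway K) ≡ []
  empties-at-last =
    Halted-empty M n (≤-reflexive (trans total (sym (+-identityʳ K)))) last-Balanced (halfway-Halted K)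

  empty⇔last : ∀ i → 1 ≤ i → i ≤ suc K → (A (afterStep2 c (m₁ ∷ M) i) ≡ []) ⇔ (i ≡ suc K)
  empty⇔last (suc j) _ sj≤ with m≤n⇒m<n∨m≡n (≤-pred sj≤)
  ... | inj₁ j<K  = mk⇔ (⊥-elim ∘ proj₁ (pops-before-last j<K (invariant j (<⇒≤ j<K))))
                        (λ e → ⊥-elim (<-irrefl (suc-injective e) j<K))
  ... | inj₂ refl = mk⇔ (λ _ → refl) (λ _ → empties-at-last)

  output-↭ : output c (m₁ ∷ M) ↭ applyUpTo suc n
  output-↭ = begin
    output c (m₁ ∷ M)          ≡⟨ cong (B ∘ foldl (iteration M) (initial n))
                                       (sym (take-all (suc K) c (≤-reflexive len-c))) ⟩
    B (stateAfter (suc K))     ≡⟨ cong B (trans (stateAfter-suc ≤-refl)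
                                                (step3-[] (halfway K) empties-at-last)) ⟩
    B (halfway K)              ↭⟨ drained M n last-Balanced empties-at-last ⟩
    applyDownFrom suc n        ≡⟨ sym (reverse-applyUpTo suc n) ⟩
    reverse (applyUpTo suc n)  ↭⟨ ↭-reverse _ ⟩
    applyUpTo suc n            ∎
    where open PermutationReasoning

lemma3p11 : (k : ℕ) → 1 ≤ k → (c m : List ℕ) → Consistent k c m →
    ((i : ℕ) → 1 ≤ i → i ≤ k → (A (afterStep2 c m i) ≡ []) ⇔ (i ≡ k))
    × (output c m ↭ applyUpTo suc (sum c))
lemma3p11 zero    () _ _ _
lemma3p11 (suc K) _  c []       cons with () ← Consistent.len-m cons
lemma3p11 (suc K) _  c (m₁ ∷ M) cons = empty⇔last , output-↭
  where open StackRun K c m₁ M cons
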